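{- Let $T$ be a tree on at least three vertices and let $S\subseteq V(T)$ satisfy conditions (I) and (II) below. Then every vertex $v\in S$ lies on a path between two leaves $\ell,\ell'\in S$. (I) $S$ contains at least one leaf of $T$. (II) For every leaf $\ell\in S$, every edge $\{a,b\}$ of $T$ such that $a$ is closer to $\ell$ than $b$ satisfies: (i) if $a,b\notin S$ then $N(b)\cap S=\emptyset$; (ii) if $a\notin S$, $b\in S$ then $|N(b)\cap S|\le1$; (iii) if $a\in S$, $b\notin S$ then $|(N(b)\cap S)\setminus\{a\}|=1$; (iv) if $a,b\in S$ then $|(N(b)\cap S)\setminus\{a\}|=0$.
   Context: $N(b)$ denotes the set of neighbors of $b$; a leaf is a vertex of degree one; distances are graph distances in $T$. -}

module Defs where

open import Data.Nat using (ℕ; zero; suc; _<_; _≤_)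
open import Data.Bool using (Bool; T)
open import Data.Fin using (Fin)
open import Data.Fin.Subset using (Subset; _∈_; _∉_; _∩_; _-_; ∣_∣)
open import Data.Vec using (tabulate)
open import Data.List using (List; []; _∷_)
open import Data.List.Relation.Unary.Unique.Propositional using (Unique)
open import Data.List.Membership.Propositional using () renaming (_∈_ to _∈ₗ_)
open import Data.Product using (Σ; ∃; _×_; _,_)
open import Relation.Nullary using (¬_)
open import Relation.Binary.PropositionalEquality using (_≡_)

record Graph (n : ℕ) : Set where
  field
    adj     : Fin n → Fin n → Bool
    sym     : ∀ u v → T (adj u v) → T (adj v u)
    irrefl  : ∀ u → ¬ T (adj u u)

module _ {n : ℕ} (G : Graph n) where
  open Graph G

  Adj : Fin n → Fin n → Set
  Adj u v = T (adj u v)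

  N : Fin n → Subset n
  N b = tabulate (adj b)

  IsLeaf : Fin n → Set
  IsLeaf v = ∣ N v ∣ ≡ 1

  data Walk : Fin n → Fin n → Set where
    [_]    : ∀ u → Walk u u
    _∷⟨_⟩_ : ∀ u {w v} → Adj u w → Walk w v → Walk u v

  verts : ∀ {u v} → Walk u v → List (Fin n)
  verts [ u ]          = u ∷ []
  verts (u ∷⟨ _ ⟩ p)   = u ∷ verts p

  len : ∀ {u v} → Walk u v → ℕ
  len [ u ]          = 0
  len (u ∷⟨ _ ⟩ p)   = suc (len p)

  IsPath : ∀ {u v} → Walk u v → Set
  IsPath p = Unique (verts p)

  Connected : Set
  Connected = ∀ u v → Walk u v

  -- a cycle: an edge u–w together with a path from w back to u with at
  -- least two edges (so the cycle has at least three vertices)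
  HasCycle : Set
  HasCycle = Σ (Fin n) λ u → Σ (Fin n) λ w → Adj u w ×
               Σ (Walk w u) λ p → IsPath p × 2 ≤ len p

  IsTree : Set
  IsTree = Connected × ¬ HasCycle

  Dist : Fin n → Fin n → ℕ → Set
  Dist u v d = (Σ (Walk u v) λ p → len p ≡ d) × (∀ (p : Walk u v) → d ≤ len p)

  Closer : Fin n → Fin n → Fin n → Set
  Closer ℓ a b = Σ ℕ λ da → Σ ℕ λ db → Dist ℓ a da × Dist ℓ b db × da < db

  CondI : Subset n → Set
  CondI S = Σ (Fin n) λ ℓ → ℓ ∈ S × IsLeaf ℓ

  CondII : Subset n → Set
  CondII S = ∀ ℓ → ℓ ∈ S → IsLeaf ℓ → ∀ a b → Adj a b → Closer ℓ a b →
      (a ∉ S → b ∉ S → ∣ N b ∩ S ∣ ≡ 0)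
    × (a ∉ S → b ∈ S → ∣ N b ∩ S ∣ ≤ 1)
    × (a ∈ S → b ∉ S → ∣ (N b ∩ S) - a ∣ ≡ 1)
    × (a ∈ S → b ∈ S → ∣ (N b ∩ S) - a ∣ ≡ 0)

  OnLeafPath : Subset n → Fin n → Set
  OnLeafPath S v = Σ (Fin n) λ ℓ → Σ (Fin n) λ ℓ' →
      ℓ ∈ S × ℓ' ∈ S × IsLeaf ℓ × IsLeaf ℓ' × ¬ (ℓ ≡ ℓ') ×
      Σ (Walk ℓ ℓ') λ p → IsPath p × v ∈ₗ verts p

{-# OPTIONS --safe #-}
-- Fix a leaf ℓ ∈ S and a path from v to ℓ, and grow it at its far end b ∈ S,
-- away from ℓ. If b is a leaf other than ℓ we are done. Otherwise, as T has no
-- cycles, any neighbour c of b other than the next vertex on the path lies off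
-- the path; if c ∉ S, condition (II)(iii) for the edge bc yields a neighbour of
-- c in S other than b. Here b is closer to ℓ than c because paths in a forest
-- are unique, hence shortest. A path has fewer than n edges, so the growth
-- stops at a leaf of S.
module Submission where

open import Defs
open import Data.Nat using (ℕ; zero; suc; _+_; _≤_; _<_; z≤n; s≤s; _≟_)
open import Data.Nat.Properties
  using (≤-refl; ≤-trans; ≤-reflexive; +-suc; +-comm; +-monoʳ-≤; m≤m+n; n<1+n; n≤1+n; m<n⇒m<1+n; <⇒≱)
open import Data.Bool.Properties using (T-≡; T-irrelevant)
open import Data.Fin as Fin using (Fin)
open import Data.Fin.Properties using (injective⇒≤) renaming (_≟_ to _≟ᶠ_)
open import Data.Fin.Subset using (Subset; _∈_; _∉_; _∩_; _─_; _-_; ∣_∣; ⁅_⁆; Nonempty)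
open import Data.Fin.Subset.Properties
  using ( _∈?_; nonempty?; Empty-unique; ∣⊥∣≡0; ∣⁅x⁆∣≡1; x∈⁅x⁆; x∈⁅y⁆⇒x≡y
        ; ⊆-antisym; x∈p∩q⁻; p─q⊆p; x∈p∧x≢y⇒x∈p-y)
open import Data.Vec as Vec using (_∷_)
open import Data.Vec.Properties using (lookup∘tabulate; []=⇒lookup; lookup⇒[]=)
open import Data.List as List using (List; _∷_; length)
open import Data.List.Relation.Unary.Any using (here; there)
open import Data.List.Relation.Unary.All as All using ([])
open import Data.List.Relation.Unary.All.Properties using (¬Any⇒All¬)
open import Data.List.Relation.Unary.AllPairs as AllPairs using ([]; _∷_)
open import Data.List.Relation.Unary.Unique.Propositional using (Unique)
open import Data.List.Relation.Unary.Unique.Propositional.Properties using (Unique[x∷xs]⇒x∉xs)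
open import Data.List.Membership.Propositional using () renaming (_∈_ to _∈ₗ_; _∉_ to _∉ₗ_)
open import Data.List.Membership.Propositional.Properties using (∈-lookup)
open import Data.List.Relation.Binary.Subset.Propositional using () renaming (_⊆_ to _⊆ₗ_)
open import Data.List.Relation.Binary.Subset.Propositional.Properties using (∷⁺ʳ)
open import Data.Product using (∃; _×_; _,_)
open import Data.Empty using (⊥; ⊥-elim)
open import Data.Sum using (_⊎_; inj₁; inj₂)
open import Function using (_∘_; id)
open import Function.Definitions using (Injective)
open import Function.Bundles using (Equivalence)
open import Relation.Nullary using (¬_; yes; no; contradiction)
open import Relation.Binary.PropositionalEquality using (_≡_; _≢_; refl; sym; trans; cong; cong₂; subst; module ≡-Reasoning)

∣p∣≡suc⇒Nonempty : ∀ {n k} {p : Subset n} → ∣ p ∣ ≡ suc k → Nonempty p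
∣p∣≡suc⇒Nonempty {n} {p = p} ∣p∣≡1+k with nonempty? p
... | yes ne  = ne
... | no  ¬ne = contradiction (trans (sym ∣p∣≡1+k) (trans (cong ∣_∣ (Empty-unique ¬ne)) (∣⊥∣≡0 n))) λ ()

x∈p─q⇒x∉q : ∀ {n} {x : Fin n} (p q : Subset n) → x ∈ p ─ q → x ∉ q
x∈p─q⇒x∉q (_ ∷ p) (_ ∷ q) (Vec.there x∈p─q) (Vec.there x∈q) = x∈p─q⇒x∉q p q x∈p─q x∈q

x∈p-y⇒x≢y : ∀ {n} {x y : Fin n} (p : Subset n) → x ∈ p - y → x ≢ y
x∈p-y⇒x≢y {y = y} p x∈p-y refl = x∈p─q⇒x∉q p ⁅ y ⁆ x∈p-y (x∈⁅x⁆ y)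

∣p∣≢1⇒Nonempty[p-x] : ∀ {n} {x : Fin n} {p : Subset n} → x ∈ p → ∣ p ∣ ≢ 1 → Nonempty (p - x)
∣p∣≢1⇒Nonempty[p-x] {x = x} {p} x∈p ∣p∣≢1 with nonempty? (p - x)
... | yes ne  = ne
... | no  ¬ne = contradiction (trans (cong ∣_∣ (⊆-antisym p⊆⁅x⁆ ⁅x⁆⊆p)) (∣⁅x⁆∣≡1 x)) ∣p∣≢1
  where
  p⊆⁅x⁆ : ∀ {y} → y ∈ p → y ∈ ⁅ x ⁆
  p⊆⁅x⁆ {y} y∈p with y ≟ᶠ x
  ... | yes refl = x∈⁅x⁆ x
  ... | no  y≢x  = contradiction (y , x∈p∧x≢y⇒x∈p-y y∈p y≢x) ¬ne
  ⁅x⁆⊆p : ∀ {y} → y ∈ ⁅ x ⁆ → y ∈ p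
  ⁅x⁆⊆p y∈⁅x⁆ = subst (_∈ p) (sym (x∈⁅y⁆⇒x≡y x y∈⁅x⁆)) x∈p

Unique⇒lookup-injective : ∀ {a} {A : Set a} {xs : List A} → Unique xs → Injective _≡_ _≡_ (List.lookup xs)
Unique⇒lookup-injective {xs = _ ∷ _} _          {Fin.zero}  {Fin.zero}  _ = refl
Unique⇒lookup-injective {xs = _ ∷ _} (x≢xs ∷ _) {Fin.zero}  {Fin.suc j} x≡xsⱼ =
  contradiction x≡xsⱼ (All.lookup x≢xs (∈-lookup j))
Unique⇒lookup-injective {xs = _ ∷ _} (x≢xs ∷ _) {Fin.suc i} {Fin.zero}  xsᵢ≡x =
  contradiction (sym xsᵢ≡x) (All.lookup x≢xs (∈-lookup i))
Unique⇒lookup-injective {xs = _ ∷ _} (_ ∷ xs!)  {Fin.suc i} {Fin.suc j} xsᵢ≡xsⱼ =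
  cong Fin.suc (Unique⇒lookup-injective xs! xsᵢ≡xsⱼ)

Unique⇒length≤ : ∀ {n} {xs : List (Fin n)} → Unique xs → length xs ≤ n
Unique⇒length≤ xs! = injective⇒≤ (Unique⇒lookup-injective xs!)

module Walks {n : ℕ} (G : Graph n) where
  open Graph G using (adj; irrefl) renaming (sym to adj-sym)
  open import Data.List.Membership.DecPropositional (_≟ᶠ_ {n}) using () renaming (_∈?_ to _∈ₗ?_)

  private
    variable
      b u v w x z : Fin n

  ∈N⇒Adj : x ∈ N G b → Adj G b x
  ∈N⇒Adj {x} {b} x∈N = Equivalence.from T-≡ (trans (sym (lookup∘tabulate (adj b) x)) ([]=⇒lookup x∈N))

  Adj⇒∈N : Adj G b x → x ∈ N G b
  Adj⇒∈N {b} {x} bx = lookup⇒[]= x (N G b) (trans (lookup∘tabulate (adj b) x) (Equivalence.to T-≡ bx))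

  leaf-neighbour : IsLeaf G b → ∃ (Adj G b)
  leaf-neighbour b-leaf with ∣p∣≡suc⇒Nonempty b-leaf
  ... | c , c∈N = c , ∈N⇒Adj c∈N

  start∈verts : (p : Walk G u v) → u ∈ₗ verts G p
  start∈verts [ u ]         = here refl
  start∈verts (u ∷⟨ _ ⟩ _) = here refl

  end∈verts : (p : Walk G u v) → v ∈ₗ verts G p
  end∈verts [ u ]         = here refl
  end∈verts (u ∷⟨ _ ⟩ p) = there (end∈verts p)

  length-verts : (p : Walk G u v) → length (verts G p) ≡ suc (len G p)
  length-verts [ u ]         = refl
  length-verts (u ∷⟨ _ ⟩ p) = cong suc (length-verts p)

  path-len<n : (p : Walk G u v) → IsPath G p → len G p < n
  path-len<n p p! = subst (_≤ n) (length-verts p) (Unique⇒length≤ p!)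

  ≢⇒0<len : u ≢ v → (p : Walk G u v) → 0 < len G p
  ≢⇒0<len u≢u [ u ]         = contradiction refl u≢u
  ≢⇒0<len _   (u ∷⟨ _ ⟩ _) = s≤s z≤n

  ∷-path : (uw : Adj G u w) (p : Walk G w v) → u ∉ₗ verts G p → IsPath G p → IsPath G (u ∷⟨ uw ⟩ p)
  ∷-path _ p u∉p p! = ¬Any⇒All¬ (verts G p) u∉p ∷ p!

  infixr 5 _++ʷ_
  _++ʷ_ : Walk G u v → Walk G v w → Walk G u w
  [ _ ]          ++ʷ q = q
  (u ∷⟨ uw ⟩ p) ++ʷ q = u ∷⟨ uw ⟩ (p ++ʷ q)

  len-++ʷ : (p : Walk G u v) (q : Walk G v w) → len G (p ++ʷ q) ≡ len G p + len G q
  len-++ʷ [ _ ]         q = refl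
  len-++ʷ (u ∷⟨ _ ⟩ p) q = cong suc (len-++ʷ p q)

  ∈-++ʷ⁻ : (p : Walk G u v) {q : Walk G v w} → z ∈ₗ verts G (p ++ʷ q) → z ∈ₗ verts G p ⊎ z ∈ₗ verts G q
  ∈-++ʷ⁻ [ _ ]         z∈q         = inj₂ z∈q
  ∈-++ʷ⁻ (u ∷⟨ _ ⟩ p) (here z≡u)  = inj₁ (here z≡u)
  ∈-++ʷ⁻ (u ∷⟨ _ ⟩ p) (there z∈) with ∈-++ʷ⁻ p z∈
  ... | inj₁ z∈p = inj₁ (there z∈p)
  ... | inj₂ z∈q = inj₂ z∈q

  reverse : Walk G u v → Walk G v u
  reverse [ u ]          = [ u ]
  reverse (u ∷⟨ uw ⟩ p) = reverse p ++ʷ (_ ∷⟨ adj-sym u _ uw ⟩ [ u ])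

  len-reverse : (p : Walk G u v) → len G (reverse p) ≡ len G p
  len-reverse [ u ]         = refl
  len-reverse (u ∷⟨ uw ⟩ p) = begin
    len G (reverse p ++ʷ (_ ∷⟨ adj-sym u _ uw ⟩ [ u ])) ≡⟨ len-++ʷ (reverse p) _ ⟩
    len G (reverse p) + 1                              ≡⟨ cong (_+ 1) (len-reverse p) ⟩
    len G p + 1                                        ≡⟨ +-comm (len G p) 1 ⟩
    suc (len G p)                                      ∎
    where open ≡-Reasoning

  ∈-reverse⁻ : (p : Walk G u v) → z ∈ₗ verts G (reverse p) → z ∈ₗ verts G p
  ∈-reverse⁻ [ u ]         z∈ = z∈
  ∈-reverse⁻ (u ∷⟨ _ ⟩ p) z∈ with ∈-++ʷ⁻ (reverse p) z∈
  ... | inj₁ z∈rev              = there (∈-reverse⁻ p z∈rev)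
  ... | inj₂ (here refl)         = there (start∈verts p)
  ... | inj₂ (there (here refl)) = here refl

  suffix : (p : Walk G u v) → z ∈ₗ verts G p → Walk G z v
  suffix [ u ]          (here refl) = [ u ]
  suffix (u ∷⟨ uw ⟩ p) (here refl) = u ∷⟨ uw ⟩ p
  suffix (u ∷⟨ _ ⟩ p)  (there z∈p) = suffix p z∈p

  len-suffix : (p : Walk G u v) (z∈p : z ∈ₗ verts G p) → len G (suffix p z∈p) ≤ len G p
  len-suffix [ u ]         (here refl) = z≤n
  len-suffix (u ∷⟨ _ ⟩ p) (here refl) = ≤-refl
  len-suffix (u ∷⟨ _ ⟩ p) (there z∈p) = ≤-trans (len-suffix p z∈p) (n≤1+n _)

  suffix-⊆ : (p : Walk G u v) (z∈p : z ∈ₗ verts G p) → verts G (suffix p z∈p) ⊆ₗ verts G p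
  suffix-⊆ [ u ]         (here refl) = id
  suffix-⊆ (u ∷⟨ _ ⟩ p) (here refl) = id
  suffix-⊆ (u ∷⟨ _ ⟩ p) (there z∈p) = there ∘ suffix-⊆ p z∈p

  suffix-path : (p : Walk G u v) (z∈p : z ∈ₗ verts G p) → IsPath G p → IsPath G (suffix p z∈p)
  suffix-path [ u ]         (here refl) p! = p!
  suffix-path (u ∷⟨ _ ⟩ p) (here refl) p! = p!
  suffix-path (u ∷⟨ _ ⟩ p) (there z∈p) (_ ∷ p!) = suffix-path p z∈p p!

  record SubPath (p : Walk G u v) : Set where
    field
      path   : Walk G u v
      isPath : IsPath G path
      len≤   : len G path ≤ len G p
      verts⊆ : verts G path ⊆ₗ verts G p

  subPath : (p : Walk G u v) → SubPath p
  subPath [ u ] = record { path = [ u ] ; isPath = [] ∷ [] ; len≤ = z≤n ; verts⊆ = id }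
  subPath (u ∷⟨ uw ⟩ p) with subPath p
  ... | record { path = q ; isPath = q! ; len≤ = q≤p ; verts⊆ = q⊆p } with u ∈ₗ? verts G q
  ...   | yes u∈q = record
    { path   = suffix q u∈q
    ; isPath = suffix-path q u∈q q!
    ; len≤   = ≤-trans (len-suffix q u∈q) (≤-trans q≤p (n≤1+n _))
    ; verts⊆ = there ∘ q⊆p ∘ suffix-⊆ q u∈q
    }
  ...   | no u∉q = record
    { path   = u ∷⟨ uw ⟩ q
    ; isPath = ∷-path uw q u∉q q!
    ; len≤   = s≤s q≤p
    ; verts⊆ = ∷⁺ʳ u q⊆p
    }

module Forest {n : ℕ} {G : Graph n} (acyclic : ¬ HasCycle G) where
  open Graph G using (irrefl) renaming (sym to adj-sym)
  open Walks G

  private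
    variable
      a b c t x x₁ x₂ y : Fin n

  no-detour : Adj G x x₁ → Adj G x x₂ → x₁ ≢ x₂ → (p : Walk G x₁ y) (q : Walk G x₂ y) →
              x ∉ₗ verts G p → x ∉ₗ verts G q → ⊥
  no-detour {x} xx₁ xx₂ x₁≢x₂ p q x∉p x∉q =
    acyclic (_ , x , adj-sym x _ xx₂ , x ∷⟨ xx₁ ⟩ s , ∷-path xx₁ s x∉s s! , s≤s (≢⇒0<len x₁≢x₂ s))
    where
    open SubPath (subPath (p ++ʷ reverse q)) renaming (path to s; isPath to s!; verts⊆ to s⊆)
    x∉s : x ∉ₗ verts G s
    x∉s x∈s with ∈-++ʷ⁻ p (s⊆ x∈s)
    ... | inj₁ x∈p = x∉p x∈p
    ... | inj₂ x∈q = x∉q (∈-reverse⁻ q x∈q)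

  path-unique : (p q : Walk G x y) → IsPath G p → IsPath G q → p ≡ q
  path-unique [ _ ]         [ _ ]         _  _  = refl
  path-unique [ _ ]         (_ ∷⟨ _ ⟩ q) _  q! = contradiction (end∈verts q) (Unique[x∷xs]⇒x∉xs q!)
  path-unique (_ ∷⟨ _ ⟩ p) [ _ ]         p! _  = contradiction (end∈verts p) (Unique[x∷xs]⇒x∉xs p!)
  path-unique (_∷⟨_⟩_ x {x₁} xx₁ p) (_∷⟨_⟩_ _ {x₂} xx₂ q) p! q! with x₁ ≟ᶠ x₂
  ... | yes refl =
    cong₂ (x ∷⟨_⟩_) (T-irrelevant xx₁ xx₂) (path-unique p q (AllPairs.tail p!) (AllPairs.tail q!))
  ... | no x₁≢x₂ =
    ⊥-elim (no-detour xx₁ xx₂ x₁≢x₂ p q (Unique[x∷xs]⇒x∉xs p!) (Unique[x∷xs]⇒x∉xs q!))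

  path-shortest : (p : Walk G x y) → IsPath G p → (q : Walk G x y) → len G p ≤ len G q
  path-shortest p p! q = subst (λ r → len G r ≤ len G q) (path-unique s p s! p!) s≤q
    where open SubPath (subPath q) renaming (path to s; isPath to s!; len≤ to s≤q)

  path⇒Dist : (p : Walk G x y) → IsPath G p → Dist G y x (len G p)
  path⇒Dist p p! =
    (reverse p , len-reverse p) , λ q → subst (len G p ≤_) (len-reverse q) (path-shortest p p! (reverse q))

  Closer-∷ : (cb : Adj G c b) (p : Walk G b t) → IsPath G (c ∷⟨ cb ⟩ p) → Closer G t b c
  Closer-∷ cb p cp! =
    len G p , suc (len G p) , path⇒Dist p (AllPairs.tail cp!) , path⇒Dist (_ ∷⟨ cb ⟩ p) cp! , n<1+n _

  neighbour∉path : (ba : Adj G b a) (p : Walk G a t) → IsPath G (b ∷⟨ ba ⟩ p) →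
                   Adj G b c → c ≢ a → c ∉ₗ verts G (b ∷⟨ ba ⟩ p)
  neighbour∉path _  _ _  bb _   (here refl) = irrefl _ bb
  neighbour∉path ba p p! bc c≢a (there c∈p) =
    no-detour ba bc (c≢a ∘ sym) p (suffix p c∈p) b∉p (b∉p ∘ suffix-⊆ p c∈p)
    where
    b∉p = Unique[x∷xs]⇒x∉xs p!

module Growth {n : ℕ} {G : Graph n} (acyclic : ¬ HasCycle G) {S : Subset n} {ℓ : Fin n}
              (ℓ∈S : ℓ ∈ S) (ℓ-leaf : IsLeaf G ℓ) (condII : CondII G S) where
  open Graph G using (irrefl) renaming (sym to adj-sym)
  open Walks G
  open Forest acyclic

  private
    variable
      b c v : Fin n

  record Extension (p : Walk G b ℓ) : Set where
    constructor extension
    field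
      start   : Fin n
      path    : Walk G start ℓ
      isPath  : IsPath G path
      start∈S : start ∈ S
      longer  : len G p < len G path
      verts⊆  : verts G p ⊆ₗ verts G path

  other-S-neighbour : (cb : Adj G c b) (p : Walk G b ℓ) → IsPath G (c ∷⟨ cb ⟩ p) → b ∈ S → c ∉ S →
                      ∃ λ y → Adj G c y × y ∈ S × y ≢ b
  other-S-neighbour {c} {b} cb p cp! b∈S c∉S
    with condII ℓ ℓ∈S ℓ-leaf b c (adj-sym c b cb) (Closer-∷ cb p cp!)
  ... | _ , _ , iii , _ with ∣p∣≡suc⇒Nonempty (iii b∈S c∉S)
  ...   | y , y∈ = let y∈N , y∈S = x∈p∩q⁻ (N G c) S (p─q⊆p (N G c ∩ S) ⁅ b ⁆ y∈)
                   in y , ∈N⇒Adj y∈N , y∈S , x∈p-y⇒x≢y (N G c ∩ S) y∈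

  extend : (cb : Adj G c b) (p : Walk G b ℓ) → IsPath G (c ∷⟨ cb ⟩ p) → b ∈ S → Extension p
  extend {c} cb p cp! b∈S with c ∈? S
  ... | yes c∈S = extension c (c ∷⟨ cb ⟩ p) cp! c∈S (n<1+n _) there
  ... | no  c∉S with other-S-neighbour cb p cp! b∈S c∉S
  ...   | y , cy , y∈S , y≢b =
    extension y (y ∷⟨ yc ⟩ (c ∷⟨ cb ⟩ p)) (∷-path yc (c ∷⟨ cb ⟩ p) (neighbour∉path cb p cp! cy y≢b) cp!)
              y∈S (m<n⇒m<1+n (n<1+n _)) (there ∘ there)
    where
    yc : Adj G y c
    yc = adj-sym c y cy

  step : (p : Walk G b ℓ) → IsPath G p → b ∈ S → (IsLeaf G b × b ≢ ℓ) ⊎ Extension p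
  step [ ℓ ] p! ℓ∈S with leaf-neighbour ℓ-leaf
  ... | c , ℓc = inj₂ (extend cℓ [ ℓ ] (∷-path cℓ [ ℓ ] c∉[ℓ] p!) ℓ∈S)
    where
    c∉[ℓ] : c ∉ₗ verts G [ ℓ ]
    c∉[ℓ] (here refl) = irrefl ℓ ℓc
    cℓ : Adj G c ℓ
    cℓ = adj-sym ℓ c ℓc
  step (b ∷⟨ ba ⟩ p) p! b∈S with ∣ N G b ∣ ≟ 1
  ... | yes b-leaf = inj₁ (b-leaf , b≢ℓ)
    where
    b≢ℓ : b ≢ ℓ
    b≢ℓ refl = Unique[x∷xs]⇒x∉xs p! (end∈verts p)
  ... | no ¬b-leaf with ∣p∣≢1⇒Nonempty[p-x] (Adj⇒∈N ba) ¬b-leaf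
  ...   | c , c∈ = inj₂ (extend cb (b ∷⟨ ba ⟩ p) (∷-path cb (b ∷⟨ ba ⟩ p) c∉bp p!) b∈S)
    where
    bc : Adj G b c
    bc = ∈N⇒Adj (p─q⊆p (N G b) ⁅ _ ⁆ c∈)
    cb : Adj G c b
    cb = adj-sym b c bc
    c∉bp : c ∉ₗ verts G (b ∷⟨ ba ⟩ p)
    c∉bp = neighbour∉path ba p p! bc (x∈p-y⇒x≢y (N G b) c∈)

  grow : ∀ k (p : Walk G b ℓ) → IsPath G p → b ∈ S → n ≤ k + len G p → v ∈ₗ verts G p → OnLeafPath G S v
  grow zero    p p! _   n≤len _ = contradiction n≤len (<⇒≱ (path-len<n p p!))
  grow (suc k) p p! b∈S n≤1+k+len v∈p with step p p! b∈S
  ... | inj₁ (b-leaf , b≢ℓ) = _ , ℓ , b∈S , ℓ∈S , b-leaf , ℓ-leaf , b≢ℓ , p , p! , v∈p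
  ... | inj₂ (extension _ p′ p′! b′∈S longer p⊆p′) =
    grow k p′ p′! b′∈S n≤k+len′ (p⊆p′ v∈p)
    where
    n≤k+len′ : n ≤ k + len G p′
    n≤k+len′ = ≤-trans n≤1+k+len (≤-trans (≤-reflexive (sym (+-suc k (len G p)))) (+-monoʳ-≤ k longer))

lemma13 : ∀ {n : ℕ} (G : Graph n) → IsTree G → 3 ≤ n →
          (S : Subset n) → CondI G S → CondII G S →
          ∀ v → v ∈ S → OnLeafPath G S v
lemma13 {n} G (connected , acyclic) _ S (ℓ , ℓ∈S , ℓ-leaf) condII v v∈S =
  grow n path isPath v∈S (m≤m+n n (len G path)) (start∈verts path)
  where
  open Walks G
  open SubPath (subPath (connected v ℓ))
  open Growth acyclic ℓ∈S ℓ-leaf condII
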